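{- Let $n \geq k \geq 2$ be powers of two and write $k = 2^h$. For any $i_1<\dots<i_h$ in $[\log_2 n]$, the sequence $f_{i_1, \ldots, i_h} \colon \{0,1,\dots,n-1\} \to \mathbb{R}$ contains $n / k$ disjoint $(12 \dots k)$-copies.
   Context: Every $t\in\{0,\dots,n-1\}$ has a unique binary representation $(b^t_1,\dots,b^t_{\log_2 n})$ with $t=\sum_j b^t_j2^{j-1}$. For $i\in[\log_2 n]$, $F_i$ flips the $i$-th bit of the binary representation. Let $f^{\downarrow}(x)=n+1-x$ and $f_{i_1,\dots,i_h}=f^{\downarrow}\circ F_{i_h}\circ\dots\circ F_{i_1}$. A $(12\dots k)$-copy in $f$ is a tuple $x_1<\dots<x_k$ with $f(x_1)<\dots<f(x_k)$; copies are disjoint if they share no element. -}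

module Defs where

open import Data.Nat using (ℕ; zero; suc; _+_; _∸_; _^_; _<_)
open import Data.Nat.DivMod using (_/_; _%_)
open import Data.Fin using (Fin) renaming (zero to fzero; suc to fsuc; _<_ to _<ᶠ_)
open import Data.Product using (_×_)
open import Relation.Binary.PropositionalEquality using (_≡_)

-- bit i (1-indexed) of t : the coefficient b^t_i in t = Σ_j b^t_j 2^(j-1)
-- (written as ⌊t / 2^(i-1)⌋ mod 2, with ⌊t/2^(i-1)⌋ computed by repeated halving)
bit : ℕ → ℕ → ℕ
bit i t = (shift (i ∸ 1) t) % 2
  where
  shift : ℕ → ℕ → ℕ
  shift zero t = t
  shift (suc j) t = shift j (t / 2)

F : ℕ → ℕ → ℕ
F i t with bit i t
... | zero = t + 2 ^ (i ∸ 1)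
... | suc _ = t ∸ 2 ^ (i ∸ 1)

-- F_{i_h} ∘ … ∘ F_{i_1} (F_{i_1} applied first)
flips : ∀ {h} → (Fin h → ℕ) → ℕ → ℕ
flips {zero} is t = t
flips {suc h} is t = flips (λ a → is (fsuc a)) (F (is fzero) t)

fdown : ℕ → ℕ → ℕ
fdown n x = suc n ∸ x

fseq : ∀ {h} → ℕ → (Fin h → ℕ) → ℕ → ℕ
fseq n is x = fdown n (flips is x)

IsCopy : (n k : ℕ) → (ℕ → ℕ) → (Fin k → ℕ) → Set
IsCopy n k f x =
  (∀ a → x a < n) ×
  (∀ a b → a <ᶠ b → x a < x b) ×
  (∀ a b → a <ᶠ b → f (x a) < f (x b))

DisjointCopies : (n k m : ℕ) → (ℕ → ℕ) → (Fin m → Fin k → ℕ) → Set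
DisjointCopies n k m f c =
  (∀ j → IsCopy n k f (c j)) ×
  (∀ j j' a b → c j a ≡ c j' b → j ≡ j')

module Submission where

-- Write a number as e + 2 * q, where e ≤ 1 is its lowest binary
-- digit.  Flipping bit 1 replaces e by 1 ∸ e, while flipping bit j ≥ 2 leaves e
-- alone and flips bit j - 1 of q.  The core of the proof is a family of
-- 2^(m-h) pairwise disjoint increasing blocks of 2^h points of {0,…,2^m - 1}
-- such that the flips F_{i_h} ∘ … ∘ F_{i_1} reverse every block: the a-th point
-- of a block goes to its (2^h - 1 - a)-th point (record Blocks).  Blocks are
-- built by induction on m, peeling off the lowest binary digit:
--   * if i_1 = 1, the lowest digit of a point is the lowest digit of its
--     position inside the block (blocks-low);
--   * if all i_j ≥ 2, it is the lowest digit of the block number (blocks-high).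
-- Since f^↓ reverses the order, f = f^↓ ∘ flips is increasing on every block,
-- so the blocks are n/k disjoint (12…k)-copies (copies-from-blocks).

open import Defs
open import Data.Nat using (ℕ; _^_; _∸_; _≤_; _<_)
open import Data.Fin using (Fin) renaming (_<_ to _<ᶠ_)
open import Data.Product using (Σ)

open import Data.Nat using (zero; suc; _+_; _*_; z≤n; s≤s; _≟_)
open import Data.Nat.Properties
open import Data.Nat.DivMod
  using (_/_; _%_; m≡m%n+[m/n]*n; [m+kn]%n≡m%n; +-distrib-/; m*n/n≡m; m*n%n≡0;
         m<n*o⇒m/o<n; m%n<n; /-monoˡ-≤; m/n*n≤m)
open import Data.Nat.Tactic.RingSolver using (solve-∀)
open import Data.Fin using (toℕ; fromℕ) renaming (zero to fzero; suc to fsuc)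
open import Data.Fin.Properties using (toℕ-fromℕ; toℕ<n; toℕ-injective)
open import Data.Vec.Functional using (tail)
open import Data.Product using (_,_; _×_; proj₂)
open import Data.Sum using (_⊎_; inj₁; inj₂)
open import Relation.Binary.PropositionalEquality
open import Relation.Nullary using (yes; no)
open ≡-Reasoning

digit-%2-self : ∀ {e} → e ≤ 1 → e % 2 ≡ e
digit-%2-self z≤n       = refl
digit-%2-self (s≤s z≤n) = refl

digit-/2-self : ∀ {e} → e ≤ 1 → e / 2 ≡ 0
digit-/2-self z≤n       = refl
digit-/2-self (s≤s z≤n) = refl

digit-%2 : ∀ {e} q → e ≤ 1 → (e + 2 * q) % 2 ≡ e
digit-%2 {e} q e≤1 = begin
  (e + 2 * q) % 2  ≡⟨ cong (λ z → (e + z) % 2) (*-comm 2 q) ⟩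
  (e + q * 2) % 2  ≡⟨ [m+kn]%n≡m%n e q 2 ⟩
  e % 2            ≡⟨ digit-%2-self e≤1 ⟩
  e                ∎

digit-/2 : ∀ {e} q → e ≤ 1 → (e + 2 * q) / 2 ≡ q
digit-/2 {e} q e≤1 = begin
  (e + 2 * q) / 2    ≡⟨ cong (λ z → (e + z) / 2) (*-comm 2 q) ⟩
  (e + q * 2) / 2    ≡⟨ +-distrib-/ e (q * 2) no-carry ⟩
  e / 2 + q * 2 / 2  ≡⟨ cong₂ _+_ (digit-/2-self e≤1) (m*n/n≡m q 2) ⟩
  q                  ∎
  where
  no-carry : e % 2 + (q * 2) % 2 < 2
  no-carry = subst (λ v → e % 2 + v < 2) (sym (m*n%n≡0 q 2))
               (subst (_< 2) (sym (+-identityʳ (e % 2))) (m%n<n e 2))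

%2≤1 : ∀ a → a % 2 ≤ 1
%2≤1 a = ≤-pred (m%n<n a 2)

digits : ∀ a → a ≡ a % 2 + 2 * (a / 2)
digits a = trans (m≡m%n+[m/n]*n a 2) (cong (a % 2 +_) (*-comm (a / 2) 2))

digits-injective : ∀ {a b} → a % 2 ≡ b % 2 → a / 2 ≡ b / 2 → a ≡ b
digits-injective {a} {b} same-low same-high = begin
  a                    ≡⟨ digits a ⟩
  a % 2 + 2 * (a / 2)  ≡⟨ cong₂ (λ e q → e + 2 * q) same-low same-high ⟩
  b % 2 + 2 * (b / 2)  ≡⟨ sym (digits b) ⟩
  b                    ∎

append-injective : ∀ {e e' x y} → e ≤ 1 → e' ≤ 1 →
  e + 2 * x ≡ e' + 2 * y → e ≡ e' × x ≡ y
append-injective {x = x} {y} e≤1 e'≤1 eq =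
  trans (sym (digit-%2 x e≤1)) (trans (cong (_% 2) eq) (digit-%2 y e'≤1)) ,
  trans (sym (digit-/2 x e≤1)) (trans (cong (_/ 2) eq) (digit-/2 y e'≤1))

append-digits : ∀ (g : ℕ → ℕ) {e} q → e ≤ 1 →
  (e + 2 * q) % 2 + 2 * g ((e + 2 * q) / 2) ≡ e + 2 * g q
append-digits g q e≤1 =
  cong₂ (λ e' q' → e' + 2 * g q') (digit-%2 q e≤1) (digit-/2 q e≤1)

append-<-bound : ∀ {e x N} → e ≤ 1 → x < N → e + 2 * x < 2 * N
append-<-bound {e} {x} {N} e≤1 x<N =
  ≤-trans (s≤s (+-monoˡ-≤ (2 * x) e≤1)) (subst (_≤ 2 * N) (*-suc 2 x) (*-monoʳ-≤ 2 x<N))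

append-< : ∀ {e e' x y} → e ≤ 1 → x < y → e + 2 * x < e' + 2 * y
append-< {e' = e'} {y = y} e≤1 x<y = ≤-trans (append-<-bound e≤1 x<y) (m≤n+m (2 * y) e')

/2-bound : ∀ {a N} → a < 2 * N → a / 2 < N
/2-bound {a} {N} a<2N = m<n*o⇒m/o<n (subst (a <_) (*-comm 2 N) a<2N)

interleave-increasing : ∀ {N} (g : ℕ → ℕ) → (∀ {x y} → x < y → y < N → g x < g y) →
  ∀ {a b} → a < b → b < 2 * N → a % 2 + 2 * g (a / 2) < b % 2 + 2 * g (b / 2)
interleave-increasing g g-inc {a} {b} a<b b<2N
  with m≤n⇒m<n∨m≡n (/-monoˡ-≤ 2 (<⇒≤ a<b))
... | inj₁ high< = append-< {e' = b % 2} (%2≤1 a) (g-inc high< (/2-bound b<2N))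
... | inj₂ same-high =
  subst (λ q → a % 2 + 2 * g q < b % 2 + 2 * g (b / 2)) (sym same-high)
        (+-monoˡ-< (2 * g (b / 2)) low<)
  where
  low< : a % 2 < b % 2
  low< = +-cancelʳ-< (2 * (b / 2)) (a % 2) (b % 2)
           (subst₂ _<_ (trans (digits a) (cong (λ q → a % 2 + 2 * q) same-high)) (digits b) a<b)

digit-cases : ∀ {e} → e ≤ 1 → e ≡ 0 ⊎ e ≡ 1
digit-cases z≤n       = inj₁ refl
digit-cases (s≤s z≤n) = inj₂ refl

-- bit (i + 2) x is bit (i + 1) of x / 2, which makes bits digits.
bit≤1 : ∀ i x → bit i x ≤ 1
bit≤1 zero          x = %2≤1 x
bit≤1 (suc zero)    x = %2≤1 x
bit≤1 (suc (suc i)) x = bit≤1 (suc i) (x / 2)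

bit-cases : ∀ i x → bit i x ≡ 0 ⊎ bit i x ≡ 1
bit-cases i x = digit-cases (bit≤1 i x)

bit-high : ∀ i {e} q → e ≤ 1 → bit (suc (suc i)) (e + 2 * q) ≡ bit (suc i) q
bit-high i q e≤1 = cong (bit (suc i)) (digit-/2 q e≤1)

F-on-0 : ∀ i x → bit i x ≡ 0 → F i x ≡ x + 2 ^ (i ∸ 1)
F-on-0 i x bit≡0 rewrite bit≡0 = refl

F-on-1 : ∀ i x → bit i x ≡ 1 → F i x ≡ x ∸ 2 ^ (i ∸ 1)
F-on-1 i x bit≡1 rewrite bit≡1 = refl

-- A set bit i + 1 contributes 2^i, so clearing it does not underflow.
set-bit-bound : ∀ i x → bit (suc i) x ≡ 1 → 2 ^ i ≤ x
set-bit-bound zero    zero    ()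
set-bit-bound zero    (suc x) _   = s≤s z≤n
set-bit-bound (suc i) x       set =
  ≤-trans (*-monoʳ-≤ 2 (set-bit-bound i (x / 2) set))
          (subst (_≤ x) (*-comm (x / 2) 2) (m/n*n≤m x 2))

F-low : ∀ {e} q → e ≤ 1 → F 1 (e + 2 * q) ≡ (1 ∸ e) + 2 * q
F-low q z≤n       = trans (F-on-0 1 (2 * q) (digit-%2 q z≤n)) (+-comm (2 * q) 1)
F-low q (s≤s z≤n) = F-on-1 1 (1 + 2 * q) (digit-%2 q (s≤s z≤n))

F-high : ∀ j {e} q → 2 ≤ j → e ≤ 1 → F j (e + 2 * q) ≡ e + 2 * F (j ∸ 1) q
F-high (suc (suc i)) {e} q (s≤s (s≤s z≤n)) e≤1 with bit-cases (suc i) q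
... | inj₁ bit≡0 = begin
  F (suc (suc i)) (e + 2 * q)  ≡⟨ F-on-0 (suc (suc i)) _ (trans (bit-high i q e≤1) bit≡0) ⟩
  e + 2 * q + 2 * 2 ^ i        ≡⟨ +-assoc e (2 * q) (2 * 2 ^ i) ⟩
  e + (2 * q + 2 * 2 ^ i)      ≡⟨ cong (e +_) (sym (*-distribˡ-+ 2 q (2 ^ i))) ⟩
  e + 2 * (q + 2 ^ i)          ≡⟨ cong (λ z → e + 2 * z) (sym (F-on-0 (suc i) q bit≡0)) ⟩
  e + 2 * F (suc i) q          ∎
... | inj₂ bit≡1 = begin
  F (suc (suc i)) (e + 2 * q)  ≡⟨ F-on-1 (suc (suc i)) _ (trans (bit-high i q e≤1) bit≡1) ⟩
  e + 2 * q ∸ 2 * 2 ^ i        ≡⟨ +-∸-assoc e (*-monoʳ-≤ 2 (set-bit-bound i q bit≡1)) ⟩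
  e + (2 * q ∸ 2 * 2 ^ i)      ≡⟨ cong (e +_) (sym (*-distribˡ-∸ 2 q (2 ^ i))) ⟩
  e + 2 * (q ∸ 2 ^ i)          ≡⟨ cong (λ z → e + 2 * z) (sym (F-on-1 (suc i) q bit≡1)) ⟩
  e + 2 * F (suc i) q          ∎

-- The index sequence seen by the remaining digits.
lower : ∀ {h} → (Fin h → ℕ) → Fin h → ℕ
lower is a = is a ∸ 1

flips-high : ∀ {h} (is : Fin h → ℕ) → (∀ a → 2 ≤ is a) → ∀ {e} q → e ≤ 1 →
  flips is (e + 2 * q) ≡ e + 2 * flips (lower is) q
flips-high {zero}  is _     q e≤1 = refl
flips-high {suc h} is all≥2 {e} q e≤1 = begin
  flips (tail is) (F (is fzero) (e + 2 * q))
    ≡⟨ cong (flips (tail is)) (F-high (is fzero) q (all≥2 fzero) e≤1) ⟩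
  flips (tail is) (e + 2 * F (lower is fzero) q)
    ≡⟨ flips-high (tail is) (λ a → all≥2 (fsuc a)) (F (lower is fzero) q) e≤1 ⟩
  e + 2 * flips (lower (tail is)) (F (lower is fzero) q)
    ∎

mirror : ℕ → ℕ → ℕ
mirror N a = N ∸ suc a

mirror-< : ∀ {a N} → a < N → mirror N a < N
mirror-< {a} {suc N} _ = s≤s (m∸n≤m N a)

mirror-antitone : ∀ {a b N} → a < b → b < N → mirror N b < mirror N a
mirror-antitone a<b b<N = ∸-monoʳ-< (s≤s a<b) b<N

double-split : ∀ {e} q d → e ≤ 1 → 2 * (suc q + d) ≡ suc (e + 2 * q) + ((1 ∸ e) + 2 * d)
double-split q d z≤n = even q d
  where
  even : ∀ q d → 2 * (suc q + d) ≡ suc (0 + 2 * q) + (1 + 2 * d)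
  even = solve-∀
double-split q d (s≤s z≤n) = odd q d
  where
  odd : ∀ q d → 2 * (suc q + d) ≡ suc (1 + 2 * q) + (0 + 2 * d)
  odd = solve-∀

mirror-digits : ∀ {a N} → a < 2 * N → mirror (2 * N) a ≡ (1 ∸ a % 2) + 2 * mirror N (a / 2)
mirror-digits {a} {N} a<2N with m≤n⇒∃[o]m+o≡n (/2-bound {a} {N} a<2N)
... | d , refl = begin
  2 * (suc (a / 2) + d) ∸ suc a
    ≡⟨ cong (λ z → 2 * (suc (a / 2) + d) ∸ suc z) (digits a) ⟩
  2 * (suc (a / 2) + d) ∸ suc (a % 2 + 2 * (a / 2))
    ≡⟨ cong (_∸ suc (a % 2 + 2 * (a / 2))) (double-split (a / 2) d (%2≤1 a)) ⟩
  suc (a % 2 + 2 * (a / 2)) + ((1 ∸ a % 2) + 2 * d) ∸ suc (a % 2 + 2 * (a / 2))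
    ≡⟨ m+n∸m≡n (suc (a % 2 + 2 * (a / 2))) _ ⟩
  (1 ∸ a % 2) + 2 * d
    ≡⟨ cong (λ z → (1 ∸ a % 2) + 2 * z) (sym (m+n∸m≡n (suc (a / 2)) d)) ⟩
  (1 ∸ a % 2) + 2 * mirror (suc (a / 2) + d) (a / 2)
    ∎

Ascending : ∀ {h} → (Fin h → ℕ) → Set
Ascending is = ∀ a b → a <ᶠ b → is a < is b

tail-ascending : ∀ {h} {is : Fin (suc h) → ℕ} → Ascending is → Ascending (tail is)
tail-ascending asc a b a<b = asc (fsuc a) (fsuc b) (s≤s a<b)

lower-ascending : ∀ {h} {is : Fin h → ℕ} → (∀ a → 1 ≤ is a) → Ascending is →
  Ascending (lower is)
lower-ascending pos asc a b a<b = ∸-monoˡ-< (asc a b a<b) (pos a)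

tail-above : ∀ {h lo} {is : Fin (suc h) → ℕ} → lo ≤ is fzero → Ascending is →
  ∀ a → lo < tail is a
tail-above lo≤first asc a = ≤-<-trans lo≤first (asc fzero (fsuc a) (s≤s z≤n))

ascending-≥ : ∀ {h lo} (is : Fin h → ℕ) → (∀ a → lo ≤ is a) → Ascending is →
  ∀ a → toℕ a + lo ≤ is a
ascending-≥ is above asc fzero = above fzero
ascending-≥ {lo = lo} is above asc (fsuc a) =
  subst (_≤ is (fsuc a)) (+-suc (toℕ a) lo)
        (ascending-≥ (tail is) (tail-above (above fzero) asc) (tail-ascending asc) a)

ascending-span : ∀ {h lo hi} (is : Fin (suc h) → ℕ) → (∀ a → lo ≤ is a) →
  (∀ a → is a ≤ hi) → Ascending is → h + lo ≤ hi
ascending-span {h} {lo} {hi} is above below asc =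
  subst (_≤ hi) (cong (_+ lo) (toℕ-fromℕ h))
        (≤-trans (ascending-≥ is above asc (fromℕ h)) (below (fromℕ h)))

-- 2^(m-h) pairwise disjoint increasing blocks of 2^h points below 2^m, each
-- reversed by flips is: block j a is the a-th point of the j-th block.
record Blocks (m h : ℕ) (is : Fin h → ℕ) : Set where
  field
    block      : ℕ → ℕ → ℕ
    in-range   : ∀ {j a} → j < 2 ^ (m ∸ h) → a < 2 ^ h → block j a < 2 ^ m
    increasing : ∀ {j a b} → j < 2 ^ (m ∸ h) → a < b → b < 2 ^ h →
                 block j a < block j b
    reversed   : ∀ {j a} → j < 2 ^ (m ∸ h) → a < 2 ^ h →
                 flips is (block j a) ≡ block j (mirror (2 ^ h) a)
    disjoint   : ∀ {j j' a b} → j < 2 ^ (m ∸ h) → j' < 2 ^ (m ∸ h) →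
                 a < 2 ^ h → b < 2 ^ h → block j a ≡ block j' b → j ≡ j'

blocks-none : ∀ m (is : Fin 0 → ℕ) → Blocks m 0 is
blocks-none m is = record
  { block      = λ j _ → j
  ; in-range   = λ j<n _ → j<n
  ; increasing = λ { _ () (s≤s z≤n) }
  ; reversed   = λ _ _ → refl
  ; disjoint   = λ _ _ _ _ same → same
  }

-- All indices ≥ 2: the lowest digit of a point is the lowest digit of its
-- block number, and the remaining digits form a block for the lowered indices.
blocks-high : ∀ {m h} {is : Fin h → ℕ} → (∀ a → 2 ≤ is a) → h ≤ m →
  Blocks m h (lower is) → Blocks (suc m) h is
blocks-high {m} {h} {is} all≥2 h≤m B = record
  { block      = λ j a → j % 2 + 2 * block (j / 2) a
  ; in-range   = λ {j} jl al → append-<-bound (%2≤1 j) (in-range (half jl) al)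
  ; increasing = λ {j} jl a<b bl →
      +-monoʳ-< (j % 2) (*-monoʳ-< 2 (increasing (half jl) a<b bl))
  ; reversed   = λ {j} jl al →
      trans (flips-high is all≥2 (block (j / 2) _) (%2≤1 j))
            (cong (λ z → j % 2 + 2 * z) (reversed (half jl) al))
  ; disjoint   = λ {j} {j'} jl jl' al bl same →
      let same-low , same-rest = append-injective (%2≤1 j) (%2≤1 j') same
      in digits-injective same-low (disjoint (half jl) (half jl') al bl same-rest)
  }
  where
  open Blocks B
  half : ∀ {j} → j < 2 ^ (suc m ∸ h) → j / 2 < 2 ^ (m ∸ h)
  half {j} jl = /2-bound (subst (λ z → j < 2 ^ z) (+-∸-assoc 1 h≤m) jl)

-- First index 1, the others ≥ 2: the lowest digit of a point is the lowest
-- digit of its position, which the flip F_1 toggles just as mirroring does.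
blocks-low : ∀ {m h} {is : Fin (suc h) → ℕ} → is fzero ≡ 1 → (∀ a → 2 ≤ tail is a) →
  Blocks m h (lower (tail is)) → Blocks (suc m) (suc h) is
blocks-low {m} {h} {is} first≡1 rest≥2 B = record
  { block      = λ j a → a % 2 + 2 * block j (a / 2)
  ; in-range   = λ {j} {a} jl al → append-<-bound (%2≤1 a) (in-range jl (/2-bound al))
  ; increasing = λ {j} jl a<b bl → interleave-increasing (block j) (increasing jl) a<b bl
  ; reversed   = reversed-low
  ; disjoint   = λ {j} {j'} {a} {b} jl jl' al bl same →
      disjoint jl jl' (/2-bound al) (/2-bound bl)
               (proj₂ (append-injective (%2≤1 a) (%2≤1 b) same))
  }
  where
  open Blocks B
  reversed-low : ∀ {j a} → j < 2 ^ (m ∸ h) → a < 2 ^ suc h →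
    flips is (a % 2 + 2 * block j (a / 2))
      ≡ mirror (2 ^ suc h) a % 2 + 2 * block j (mirror (2 ^ suc h) a / 2)
  reversed-low {j} {a} jl al = begin
    flips is (a % 2 + 2 * block j (a / 2))
      ≡⟨ cong (λ i → flips (tail is) (F i (a % 2 + 2 * block j (a / 2)))) first≡1 ⟩
    flips (tail is) (F 1 (a % 2 + 2 * block j (a / 2)))
      ≡⟨ cong (flips (tail is)) (F-low (block j (a / 2)) (%2≤1 a)) ⟩
    flips (tail is) ((1 ∸ a % 2) + 2 * block j (a / 2))
      ≡⟨ flips-high (tail is) rest≥2 (block j (a / 2)) (m∸n≤m 1 (a % 2)) ⟩
    (1 ∸ a % 2) + 2 * flips (lower (tail is)) (block j (a / 2))
      ≡⟨ cong (λ z → (1 ∸ a % 2) + 2 * z) (reversed jl (/2-bound al)) ⟩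
    (1 ∸ a % 2) + 2 * block j (mirror (2 ^ h) (a / 2))
      ≡⟨ sym (append-digits (block j) (mirror (2 ^ h) (a / 2)) (m∸n≤m 1 (a % 2))) ⟩
    r % 2 + 2 * block j (r / 2)
      ≡⟨ cong (λ z → z % 2 + 2 * block j (z / 2)) (sym (mirror-digits {a} {2 ^ h} al)) ⟩
    mirror (2 ^ suc h) a % 2 + 2 * block j (mirror (2 ^ suc h) a / 2)
      ∎
    where
    r : ℕ
    r = (1 ∸ a % 2) + 2 * mirror (2 ^ h) (a / 2)

blocks : ∀ m h (is : Fin h → ℕ) → h ≤ m → (∀ a → 1 ≤ is a) → (∀ a → is a ≤ m) →
  Ascending is → Blocks m h is
blocks m       zero    is _  _ _ _ = blocks-none m is
blocks zero    (suc h) is () _ _ _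
blocks (suc m) (suc h) is h≤m pos below asc with is fzero ≟ 1
... | yes first≡1 =
  blocks-low first≡1 rest≥2
    (blocks m h (lower (tail is)) (≤-pred h≤m)
       (λ a → ∸-monoˡ-≤ 1 (rest≥2 a)) (λ a → ∸-monoˡ-≤ 1 (below (fsuc a)))
       (lower-ascending (λ a → <⇒≤ (rest≥2 a)) (tail-ascending asc)))
  where
  rest≥2 : ∀ a → 2 ≤ tail is a
  rest≥2 = tail-above (pos fzero) asc
... | no first≢1 =
  blocks-high all≥2 h<m
    (blocks m (suc h) (lower is) h<m
       (λ a → ∸-monoˡ-≤ 1 (all≥2 a)) (λ a → ∸-monoˡ-≤ 1 (below a))
       (lower-ascending pos asc))
  where
  all≥2 : ∀ a → 2 ≤ is a
  all≥2 fzero    = ≤∧≢⇒< (pos fzero) (λ 1≡first → first≢1 (sym 1≡first))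
  all≥2 (fsuc a) = tail-above (pos fzero) asc a
  h<m : suc h ≤ m
  h<m = ≤-pred (subst (_≤ suc m) (+-comm h 2) (ascending-span is all≥2 below asc))

fdown-antitone : ∀ {n x y} → x < y → y ≤ n → fdown n y < fdown n x
fdown-antitone {n} x<y y≤n = ∸-monoʳ-< x<y (≤-trans y≤n (n≤1+n n))

copies-from-blocks : ∀ {m h} {is : Fin h → ℕ} → Blocks m h is →
  Σ (Fin (2 ^ (m ∸ h)) → Fin (2 ^ h) → ℕ)
    (DisjointCopies (2 ^ m) (2 ^ h) (2 ^ (m ∸ h)) (fseq (2 ^ m) is))
copies-from-blocks {m} {h} {is} B =
  (λ j a → block (toℕ j) (toℕ a)) ,
  (λ j → (λ a → in-range (toℕ<n j) (toℕ<n a)) ,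
         (λ a b a<b → increasing (toℕ<n j) a<b (toℕ<n b)) ,
         (λ a b a<b → f-increasing (toℕ<n j) a<b (toℕ<n b))) ,
  (λ j j' a b same → toℕ-injective (disjoint (toℕ<n j) (toℕ<n j') (toℕ<n a) (toℕ<n b) same))
  where
  open Blocks B
  f-increasing : ∀ {j a b} → j < 2 ^ (m ∸ h) → a < b → b < 2 ^ h →
    fseq (2 ^ m) is (block j a) < fseq (2 ^ m) is (block j b)
  f-increasing {j} {a} {b} jl a<b bl =
    subst₂ _<_ (sym (cong (fdown (2 ^ m)) (reversed jl al)))
               (sym (cong (fdown (2 ^ m)) (reversed jl bl)))
      (fdown-antitone (increasing jl (mirror-antitone a<b bl) (mirror-< al))
                      (<⇒≤ (in-range jl (mirror-< al))))
    where
    al : a < 2 ^ h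
    al = <-trans a<b bl

lemma4p11 : (m h : ℕ) → 1 ≤ h → h ≤ m →
    (is : Fin h → ℕ) →
    (∀ a → 1 ≤ is a) → (∀ a → is a ≤ m) →
    (∀ a b → a <ᶠ b → is a < is b) →
    Σ (Fin (2 ^ (m ∸ h)) → Fin (2 ^ h) → ℕ)
      (DisjointCopies (2 ^ m) (2 ^ h) (2 ^ (m ∸ h)) (fseq (2 ^ m) is))
lemma4p11 m h _ h≤m is pos below asc = copies-from-blocks (blocks m h is h≤m pos below asc)
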